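{- For $d\geq 2p+1$, we have \[ N_{\mathrm{trop}}(p,d) \geq U(d,d-p-1) \enspace . \]
   Context: $U(n,k)$ is McMullen's upper bound: $U(n,k)=\binom{n-\lfloor k/2\rfloor}{\lfloor k/2\rfloor}+\binom{n-\lfloor k/2\rfloor-1}{\lfloor k/2\rfloor-1}$ for $k$ even and $U(n,k)=2\binom{n-\lfloor k/2\rfloor-1}{\lfloor k/2\rfloor}$ for $k$ odd (equivalently, the number of $k$-element subsets of $\{1,\dots,n\}$ satisfying Gale's evenness condition). A sign pattern is a $p\times d$ array $(\epsilon_{ij})$ of signs $+$ or $-$. Positions $(i,j)$ are viewed as entries of a $p\times d$ matrix ($(1,1)$ top left). An oriented lattice path starts at some $(1,j)$, ends at some $(p,j')$, each step going one position down or one to the right; it consists of vertical and horizontal segments. It is tropically allowed for $(\epsilon_{ij})$ if: (i) every sign on the initial vertical segment, except possibly the bottom one, is $+$; (ii) every sign on the final vertical segment, except possibly the top one, is $+$; (iii) every sign on any other vertical segment, except possibly its top and bottom signs, is $+$; (iv) for every horizontal segment, the pair (sign of leftmost position, sign of rightmost position) is $(+,-)$ or $(-,+)$; (v) once a pair $(-,+)$ occurs for some horizontal segment, all horizontal segments below it also have pair $(-,+)$. $N_{\mathrm{trop}}(p,d)$ is the maximal number, over all $p\times d$ sign patterns, of tropically allowed lattice paths. -}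

module Defs where

open import Data.Nat using (ℕ; zero; suc; _+_; _*_; _∸_; _⊔_; _≤ᵇ_; _<ᵇ_; _≡ᵇ_; _%_; ⌊_/2⌋)
open import Data.Nat.Combinatorics using (_C_)
open import Data.Bool using (Bool; true; false; _∧_; _∨_; not; if_then_else_)
open import Data.List using (List; []; _∷_; map; concatMap; upTo; allFin; foldr)
open import Data.Vec using (Vec; []; _∷_)
open import Data.Fin using (Fin; toℕ)

-- McMullen's upper bound U(n,k), with m = ⌊k/2⌋:
--   k even : C(n-m, m) + C(n-m-1, m-1)   (second term is 0 when m = 0)
--   k odd  : 2 * C(n-m-1, m)

U : ℕ → ℕ → ℕ
U n k with k % 2
... | zero  = ((n ∸ ⌊ k /2⌋) C ⌊ k /2⌋) + second ⌊ k /2⌋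
  where
  second : ℕ → ℕ
  second zero    = 0
  second (suc m) = (n ∸ suc m ∸ 1) C m
... | suc _ = 2 * ((n ∸ ⌊ k /2⌋ ∸ 1) C ⌊ k /2⌋)

-- Signs and sign patterns (p × d arrays; row i, column j, 0-indexed here)

every : {A : Set} → (A → Bool) → List A → Bool
every f []       = true
every f (x ∷ xs) = f x ∧ every f xs

total : List ℕ → ℕ
total []       = 0
total (x ∷ xs) = x + total xs

data Sign : Set where
  ⊕ ⊖ : Sign

isPlus : Sign → Bool
isPlus ⊕ = true
isPlus ⊖ = false

isMinus : Sign → Bool
isMinus s = not (isPlus s)

SignPattern : ℕ → ℕ → Set
SignPattern p d = Vec (Vec Sign d) p

-- entry lookup with a default outside the range (never used in range checks)
nth : {A : Set} → A → List A → ℕ → A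
nth x []       _       = x
nth x (y ∷ ys) zero    = y
nth x (y ∷ ys) (suc n) = nth x ys n

vecToList : {A : Set} {n : ℕ} → Vec A n → List A
vecToList []       = []
vecToList (x ∷ xs) = x ∷ vecToList xs

entry : {p d : ℕ} → SignPattern p d → ℕ → ℕ → Sign
entry ε i j = nth ⊕ (nth [] (map vecToList (vecToList ε)) i) j

-- Oriented lattice paths in a p × d grid (p ≥ 1).
-- Such a path is encoded by its column sequence a₀ ≤ a₁ ≤ … ≤ a_p
-- (entries in Fin d): in row i (0 ≤ i < p) the path occupies the
-- positions (i, a_i), (i, a_i + 1), …, (i, a_{i+1}) and then steps down
-- from (i, a_{i+1}) to (i+1, a_{i+1}).  It starts at (0, a₀), ends at
-- (p-1, a_p).  This is a bijection with down/right lattice paths from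
-- the first to the last row.

PathCode : ℕ → ℕ → Set
PathCode p d = Vec (Fin d) (suc p)

col : {p d : ℕ} → PathCode p d → ℕ → ℕ
col a r = nth 0 (map toℕ (vecToList a)) r

isPath : {p d : ℕ} → PathCode p d → Bool
isPath {p} a = every (λ i → col a i ≤ᵇ col a (suc i)) (upTo p)

module Allowed {p d : ℕ} (ε : SignPattern p d) (a : PathCode p d) where

  A : ℕ → ℕ
  A = col a

  s : ℕ → ℕ → Sign
  s = entry ε

  rows : List ℕ
  rows = upTo p

  onPath : ℕ → ℕ → Bool
  onPath i c = (i <ᵇ p) ∧ (A i ≤ᵇ c) ∧ (c ≤ᵇ A (suc i))

  -- (i , c) is the top / bottom position of the vertical segment
  -- (maximal run of path positions in column c) containing it
  isTop : ℕ → ℕ → Bool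
  isTop i c = (i ≡ᵇ 0) ∨ not (onPath (i ∸ 1) c)

  isBottom : ℕ → ℕ → Bool
  isBottom i c = (suc i ≡ᵇ p) ∨ not (onPath (suc i) c)

  condI : Bool
  condI = every (λ i → not (onPath i (A 0)) ∨ isBottom i (A 0) ∨ isPlus (s i (A 0))) rows

  condII : Bool
  condII = every (λ i → not (onPath i (A p)) ∨ isTop i (A p) ∨ isPlus (s i (A p))) rows

  condIII : Bool
  condIII = every (λ c → (c ≡ᵇ A 0) ∨ (c ≡ᵇ A p) ∨
                  every (λ i → not (onPath i c) ∨ isTop i c ∨ isBottom i c ∨ isPlus (s i c)) rows)
                (upTo d)

  -- horizontal segment in row i: from (i , a_i) to (i , a_{i+1}), a_i < a_{i+1}
  horizontal : ℕ → Bool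
  horizontal i = A i <ᵇ A (suc i)

  pairPM : ℕ → Bool
  pairPM i = isPlus (s i (A i)) ∧ isMinus (s i (A (suc i)))

  pairMP : ℕ → Bool
  pairMP i = isMinus (s i (A i)) ∧ isPlus (s i (A (suc i)))

  condIV : Bool
  condIV = every (λ i → not (horizontal i) ∨ pairPM i ∨ pairMP i) rows

  condV : Bool
  condV = every (λ i → every (λ i' → not (i <ᵇ i') ∨ not (horizontal i ∧ pairMP i)
                                 ∨ not (horizontal i') ∨ pairMP i') rows) rows

  allowed : Bool
  allowed = condI ∧ condII ∧ condIII ∧ condIV ∧ condV

tropicallyAllowed : {p d : ℕ} → SignPattern p d → PathCode p d → Bool
tropicallyAllowed ε a = Allowed.allowed ε a

vecsOf : {A : Set} (n : ℕ) → List A → List (Vec A n)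
vecsOf zero    xs = [] ∷ []
vecsOf (suc n) xs = concatMap (λ x → map (x ∷_) (vecsOf n xs)) xs

allPathCodes : (p d : ℕ) → List (PathCode p d)
allPathCodes p d = vecsOf (suc p) (allFin d)

allSignPatterns : (p d : ℕ) → List (SignPattern p d)
allSignPatterns p d = vecsOf p (vecsOf d (⊕ ∷ ⊖ ∷ []))

numAllowedPaths : {p d : ℕ} → SignPattern p d → ℕ
numAllowedPaths {p} {d} ε =
  total (map (λ a → if isPath a ∧ tropicallyAllowed ε a then 1 else 0) (allPathCodes p d))

Ntrop : ℕ → ℕ → ℕ
Ntrop p d = foldr _⊔_ 0 (map numAllowedPaths (allSignPatterns p d))

module Submission where

-- Take the checkerboard pattern, + at (i, j) iff i + j is even, and encode a lattice path by
-- its columns a₀ ≤ a₁ ≤ … ≤ a_p in the successive rows. If the aᵢ increase with odd gaps, every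
-- vertical segment is just a top and a bottom, and every horizontal segment reads (s, −s) with
-- s the sign at (0, a₀), so the path is tropically allowed. Such sequences in {0, …, d − 1}
-- starting at an even column are counted by C(p + 1 + m, m) where d − p − 1 = 2m + e, e ≤ 1,
-- and those starting at an odd column likewise with d − 1 in place of d; the two numbers add
-- up to U(d, d − p − 1).

open import Defs
open import Data.Nat using (ℕ; zero; suc; _≤_; _<_; _+_; _*_; _∸_; _⊔_; _≤ᵇ_; _<ᵇ_; _≡ᵇ_; _%_; ⌊_/2⌋; z≤n; s≤s; z<s; s<s)
open import Data.Nat.Properties
open import Data.Nat.Combinatorics using (_C_; nCn≡1; nCk+nC[k+1]≡[n+1]C[k+1])
open import Data.Nat.Tactic.RingSolver using (solve-∀)
open import Algebra.Properties.CommutativeSemigroup +-commutativeSemigroup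
  using () renaming (interchange to +-interchange)
open import Data.Bool using (Bool; true; false; _∧_; _∨_; not; if_then_else_; T)
open import Data.Bool.Properties using (not-involutive; T-∧; T-∨)
open import Data.List using (List; []; _∷_; _++_; map; concatMap; upTo; applyUpTo; allFin; foldr)
open import Data.List.Properties using (map-∘; map-cong; map-tabulate)
open import Data.List.Membership.Propositional using (_∈_)
open import Data.List.Membership.Propositional.Properties using (∈-map⁺; ∈-concatMap⁺)
open import Data.List.Relation.Unary.Any as Any using (here; there)
open import Data.Vec using (Vec; []; _∷_; tabulate)
open import Data.Fin as Fin using (Fin; toℕ)
open import Data.Fin.Properties using (toℕ<n)
open import Data.Product using (_×_; _,_; proj₁; proj₂; Σ)
open import Data.Sum using (_⊎_; inj₁; inj₂)
open import Data.Empty using (⊥; ⊥-elim)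
open import Data.Unit using (tt)
open import Function using (_∘_; id)
open import Function.Bundles using (Equivalence)
open import Relation.Nullary using (¬_)
open import Relation.Binary.PropositionalEquality

∧-intro : ∀ {x y} → T x → T y → T (x ∧ y)
∧-intro tx ty = Equivalence.from T-∧ (tx , ty)

∧-elim : ∀ {x y} → T (x ∧ y) → T x × T y
∧-elim = Equivalence.to T-∧

∨-introˡ : ∀ {x} y → T x → T (x ∨ y)
∨-introˡ _ tx = Equivalence.from T-∨ (inj₁ tx)

∨-introʳ : ∀ x {y} → T y → T (x ∨ y)
∨-introʳ _ ty = Equivalence.from T-∨ (inj₂ ty)

not-intro : ∀ {x} → ¬ T x → T (not x)
not-intro {true}  ¬tx = ¬tx tt
not-intro {false} _   = tt

→-intro : ∀ {x y} → (T x → T y) → T (not x ∨ y)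
→-intro {true}  h = h tt
→-intro {false} _ = tt

T-not∨b∨not-b : ∀ h b → T (not h ∨ b ∨ not b)
T-not∨b∨not-b false _     = tt
T-not∨b∨not-b true  true  = tt
T-not∨b∨not-b true  false = tt

T-∨-not-∧-∨ : ∀ u w v x → T (u ∨ not (w ∧ x) ∨ v ∨ x)
T-∨-not-∧-∨ true  _     _     _     = tt
T-∨-not-∧-∨ false false _     _     = tt
T-∨-not-∧-∨ false true  _     false = tt
T-∨-not-∧-∨ false true  false true  = tt
T-∨-not-∧-∨ false true  true  true  = tt

every-applyUpTo : ∀ {A : Set} {f : A → Bool} (g : ℕ → A) n →
  (∀ {i} → i < n → T (f (g i))) → T (every f (applyUpTo g n))
every-applyUpTo g zero    _ = tt
every-applyUpTo g (suc n) h = ∧-intro (h z<s) (every-applyUpTo (g ∘ suc) n (h ∘ s<s))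

every-upTo : ∀ {f : ℕ → Bool} {n} → (∀ {i} → i < n → T (f i)) → T (every f (upTo n))
every-upTo {n = n} = every-applyUpTo id n

isEven : ℕ → Bool
isEven zero    = true
isEven (suc n) = not (isEven n)

indicator : Bool → ℕ
indicator b = if b then 1 else 0

T⇒1≤indicator : ∀ {b} → T b → 1 ≤ indicator b
T⇒1≤indicator {true} _ = ≤-refl

indicator-+-≤ : ∀ x y {z} → (T x → T z) → (T y → T z) → (T x → T y → ⊥) →
  indicator x + indicator y ≤ indicator z
indicator-+-≤ true  true  _  _  disjoint = ⊥-elim (disjoint tt tt)
indicator-+-≤ true  false hx _  _        = T⇒1≤indicator (hx tt)
indicator-+-≤ false true  _  hy _        = T⇒1≤indicator (hy tt)
indicator-+-≤ false false _  _  _        = z≤n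

module _ {A : Set} where

  total-map-cong : {f g : A → ℕ} → (∀ x → f x ≡ g x) → (xs : List A) →
    total (map f xs) ≡ total (map g xs)
  total-map-cong f≗g xs = cong total (map-cong f≗g xs)

  total-map-zero : {f : A → ℕ} → (∀ x → f x ≡ 0) → (xs : List A) → total (map f xs) ≡ 0
  total-map-zero f≗0 []       = refl
  total-map-zero f≗0 (x ∷ xs) = cong₂ _+_ (f≗0 x) (total-map-zero f≗0 xs)

  total-map-+ : (f g : A → ℕ) (xs : List A) →
    total (map (λ x → f x + g x) xs) ≡ total (map f xs) + total (map g xs)
  total-map-+ f g []       = refl
  total-map-+ f g (x ∷ xs) =
    trans (cong (f x + g x +_) (total-map-+ f g xs)) (+-interchange (f x) (g x) _ _)

  total-map-mono : {f g : A → ℕ} → (∀ x → f x ≤ g x) → (xs : List A) →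
    total (map f xs) ≤ total (map g xs)
  total-map-mono f≤g []       = z≤n
  total-map-mono f≤g (x ∷ xs) = +-mono-≤ (f≤g x) (total-map-mono f≤g xs)

  total-map-++ : (f : A → ℕ) (xs ys : List A) →
    total (map f (xs ++ ys)) ≡ total (map f xs) + total (map f ys)
  total-map-++ f []       ys = refl
  total-map-++ f (x ∷ xs) ys =
    trans (cong (f x +_) (total-map-++ f xs ys)) (sym (+-assoc (f x) _ _))

  total-indicator-∧ : ∀ b (r : A → Bool) (xs : List A) →
    total (map (λ v → indicator (b ∧ r v)) xs) ≡ (if b then total (map (indicator ∘ r) xs) else 0)
  total-indicator-∧ true  r xs = refl
  total-indicator-∧ false r xs = total-map-zero (λ _ → refl) xs

total-map-concatMap : {A B : Set} (f : B → ℕ) (g : A → List B) (xs : List A) →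
  total (map f (concatMap g xs)) ≡ total (map (λ x → total (map f (g x))) xs)
total-map-concatMap f g []       = refl
total-map-concatMap f g (x ∷ xs) =
  trans (total-map-++ f (g x) (concatMap g xs)) (cong (total (map f (g x)) +_) (total-map-concatMap f g xs))

sumFin : ℕ → (ℕ → ℕ) → ℕ
sumFin d f = total (map (f ∘ toℕ) (allFin d))

sumFin-suc : ∀ d (f : ℕ → ℕ) → sumFin (suc d) f ≡ f 0 + sumFin d (f ∘ suc)
sumFin-suc d f = cong (λ xs → f 0 + total xs)
  (trans (map-tabulate {n = d} Fin.suc (f ∘ toℕ)) (sym (map-tabulate {n = d} id (f ∘ suc ∘ toℕ))))

sumFin-point : ∀ {lo d} (g : ℕ → ℕ) → lo < d → sumFin d (λ x → if lo ≡ᵇ x then g x else 0) ≡ g lo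
sumFin-point {zero} {suc d} g _ = trans (sumFin-suc d (λ x → if 0 ≡ᵇ x then g x else 0))
  (trans (cong (g 0 +_) (total-map-zero (λ _ → refl) (allFin d))) (+-identityʳ (g 0)))
sumFin-point {suc lo} {suc d} g (s<s lo<d) =
  trans (sumFin-suc d (λ x → if suc lo ≡ᵇ x then g x else 0)) (sumFin-point (g ∘ suc) lo<d)

-- evenGap lo x holds iff x = lo + 2t for some t.
evenGap : ℕ → ℕ → Bool
evenGap zero     zero          = true
evenGap zero     (suc zero)    = false
evenGap zero     (suc (suc x)) = evenGap zero x
evenGap (suc lo) zero          = false
evenGap (suc lo) (suc x)       = evenGap lo x

evenGap⇒≤ : ∀ lo x → T (evenGap lo x) → lo ≤ x
evenGap⇒≤ zero     x       _ = z≤n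
evenGap⇒≤ (suc lo) (suc x) h = s≤s (evenGap⇒≤ lo x h)

evenGap⇒isEven≡ : ∀ lo x → T (evenGap lo x) → isEven x ≡ isEven lo
evenGap⇒isEven≡ zero     zero          _ = refl
evenGap⇒isEven≡ zero     (suc (suc x)) h = trans (not-involutive (isEven x)) (evenGap⇒isEven≡ zero x h)
evenGap⇒isEven≡ (suc lo) (suc x)       h = cong not (evenGap⇒isEven≡ lo x h)

if-evenGap-split : ∀ lo x (g : ℕ) →
  (if evenGap lo x then g else 0) ≡ (if lo ≡ᵇ x then g else 0) + (if evenGap (2 + lo) x then g else 0)
if-evenGap-split zero     zero          g = sym (+-identityʳ g)
if-evenGap-split zero     (suc zero)    g = refl
if-evenGap-split zero     (suc (suc x)) g = refl
if-evenGap-split (suc lo) zero          g = refl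
if-evenGap-split (suc lo) (suc x)       g = if-evenGap-split lo x g

oddGapsFrom : {d n : ℕ} → ℕ → Vec (Fin d) n → Bool
oddGapsFrom lo []      = true
oddGapsFrom lo (x ∷ v) = evenGap lo (toℕ x) ∧ oddGapsFrom (suc (toℕ x)) v

module _ {d : ℕ} where

  oddGapsFrom-head : ∀ {n} lo (x : Fin d) (v : Vec (Fin d) n) →
    T (oddGapsFrom lo (x ∷ v)) → T (evenGap lo (toℕ x))
  oddGapsFrom-head lo x v = proj₁ ∘ ∧-elim {evenGap lo (toℕ x)}

  oddGapsFrom-tail : ∀ {n} lo (x : Fin d) (v : Vec (Fin d) n) →
    T (oddGapsFrom lo (x ∷ v)) → T (oddGapsFrom (suc (toℕ x)) v)
  oddGapsFrom-tail lo x v = proj₂ ∘ ∧-elim {evenGap lo (toℕ x)}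

  col<d : ∀ {n i} (v : Vec (Fin d) (suc n)) → i ≤ n → col v i < d
  col<d {i = zero}  (x ∷ v) _         = toℕ<n x
  col<d {i = suc i} (x ∷ v) (s≤s i≤n) = col<d v i≤n

  oddGapsFrom⇒col< : ∀ {n lo i} (v : Vec (Fin d) (suc n)) → T (oddGapsFrom lo v) →
    i < n → col v i < col v (suc i)
  oddGapsFrom⇒col< {lo = lo} {zero} (x ∷ y ∷ w) gaps _ =
    evenGap⇒≤ (suc (toℕ x)) (toℕ y) (oddGapsFrom-head (suc (toℕ x)) y w (oddGapsFrom-tail lo x (y ∷ w) gaps))
  oddGapsFrom⇒col< {lo = lo} {suc i} (x ∷ v) gaps (s<s i<n) =
    oddGapsFrom⇒col< v (oddGapsFrom-tail lo x v gaps) i<n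

  oddGapsFrom⇒isEven≡ : ∀ {n lo i} (v : Vec (Fin d) (suc n)) → T (oddGapsFrom lo v) →
    i ≤ n → isEven (i + col v i) ≡ isEven lo
  oddGapsFrom⇒isEven≡ {lo = lo} {zero} (x ∷ v) gaps _ =
    evenGap⇒isEven≡ lo (toℕ x) (oddGapsFrom-head lo x v gaps)
  oddGapsFrom⇒isEven≡ {lo = lo} {suc i} (x ∷ v) gaps (s≤s i≤n) = trans
    (cong not (oddGapsFrom⇒isEven≡ v (oddGapsFrom-tail lo x v gaps) i≤n))
    (trans (not-involutive _) (evenGap⇒isEven≡ lo (toℕ x) (oddGapsFrom-head lo x v gaps)))

  oddGapsFrom⇒fits : ∀ {n lo} (v : Vec (Fin d) (suc n)) → T (oddGapsFrom lo v) → lo + n < d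
  oddGapsFrom⇒fits {lo = lo} (x ∷ []) gaps = begin-strict
    lo + 0  ≡⟨ +-identityʳ lo ⟩
    lo      ≤⟨ evenGap⇒≤ lo (toℕ x) (oddGapsFrom-head lo x [] gaps) ⟩
    toℕ x   <⟨ toℕ<n x ⟩
    d       ∎
    where open ≤-Reasoning
  oddGapsFrom⇒fits {suc n} {lo} (x ∷ v) gaps = begin-strict
    lo + suc n         ≤⟨ +-monoˡ-≤ (suc n) (evenGap⇒≤ lo (toℕ x) (oddGapsFrom-head lo x v gaps)) ⟩
    toℕ x + suc n      ≡⟨ +-suc (toℕ x) n ⟩
    suc (toℕ x) + n    <⟨ oddGapsFrom⇒fits v (oddGapsFrom-tail lo x v gaps) ⟩
    d                  ∎
    where open ≤-Reasoning

  oddGapsFrom-0-1-disjoint : ∀ {n} (v : Vec (Fin d) (suc n)) →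
    T (oddGapsFrom 0 v) → T (oddGapsFrom 1 v) → ⊥
  oddGapsFrom-0-1-disjoint (x ∷ v) gaps₀ gaps₁ with
    trans (sym (evenGap⇒isEven≡ 0 (toℕ x) (oddGapsFrom-head 0 x v gaps₀)))
          (evenGap⇒isEven≡ 1 (toℕ x) (oddGapsFrom-head 1 x v gaps₁))
  ... | ()

countOddGaps : ℕ → ℕ → ℕ → ℕ
countOddGaps d n lo = total (map (indicator ∘ oddGapsFrom lo) (vecsOf n (allFin d)))

countOddGaps-suc : ∀ d n lo →
  countOddGaps d (suc n) lo ≡ sumFin d (λ x → if evenGap lo x then countOddGaps d n (suc x) else 0)
countOddGaps-suc d n lo =
  trans (total-map-concatMap (indicator ∘ oddGapsFrom lo) (λ x → map (x ∷_) V) (allFin d))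
        (total-map-cong (λ x → trans (cong total (sym (map-∘ V)))
                                    (total-indicator-∧ (evenGap lo (toℕ x)) (oddGapsFrom (suc (toℕ x))) V))
                        (allFin d))
  where
  V = vecsOf n (allFin d)

-- The sequence either starts exactly at lo, or it is an odd-gap sequence from 2 + lo.
countOddGaps-step : ∀ {d n lo} → lo < d →
  countOddGaps d (suc n) lo ≡ countOddGaps d n (suc lo) + countOddGaps d (suc n) (2 + lo)
countOddGaps-step {d} {n} {lo} lo<d = begin
  countOddGaps d (suc n) lo
    ≡⟨ countOddGaps-suc d n lo ⟩
  sumFin d (λ x → if evenGap lo x then c (suc x) else 0)
    ≡⟨ total-map-cong (λ x → if-evenGap-split lo (toℕ x) (c (suc (toℕ x)))) (allFin d) ⟩
  sumFin d (λ x → (if lo ≡ᵇ x then c (suc x) else 0) + (if evenGap (2 + lo) x then c (suc x) else 0))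
    ≡⟨ total-map-+ _ _ (allFin d) ⟩
  sumFin d (λ x → if lo ≡ᵇ x then c (suc x) else 0) + sumFin d (λ x → if evenGap (2 + lo) x then c (suc x) else 0)
    ≡⟨ cong₂ _+_ (sumFin-point (c ∘ suc) lo<d) (sym (countOddGaps-suc d n (2 + lo))) ⟩
  c (suc lo) + countOddGaps d (suc n) (2 + lo)
    ∎
  where
  open ≡-Reasoning
  c = countOddGaps d n

countOddGaps-empty : ∀ {d n lo} → d ≤ lo + n → countOddGaps d (suc n) lo ≡ 0
countOddGaps-empty {d} {n} {lo} d≤lo+n = total-map-zero none (vecsOf (suc n) (allFin d))
  where
  none : (v : Vec (Fin d) (suc n)) → indicator (oddGapsFrom lo v) ≡ 0
  none v with oddGapsFrom lo v in eq
  ... | true  = ⊥-elim (≤⇒≯ d≤lo+n (oddGapsFrom⇒fits v (subst T (sym eq) tt)))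
  ... | false = refl

C-pascal : ∀ n m → (n + suc m) C suc m + (suc n + m) C m ≡ (suc n + suc m) C suc m
C-pascal n m = begin
  (n + suc m) C suc m + (suc n + m) C m    ≡⟨ cong (λ t → t C suc m + (suc n + m) C m) (+-suc n m) ⟩
  (suc n + m) C suc m + (suc n + m) C m    ≡⟨ +-comm ((suc n + m) C suc m) _ ⟩
  (suc n + m) C m + (suc n + m) C suc m    ≡⟨ nCk+nC[k+1]≡[n+1]C[k+1] (suc n + m) m ⟩
  suc (suc n + m) C suc m                  ≡⟨ cong (_C suc m) (sym (+-suc (suc n) m)) ⟩
  (suc n + suc m) C suc m                  ∎
  where open ≡-Reasoning

-- Writing the first entry as lo + 2g₀ and the later gaps as 1 + 2gᵢ, the n numbers gᵢ have sum at most m.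
countOddGaps-binomial : ∀ n m {d lo e} → e ≤ 1 → lo + (n + (m + m) + e) ≡ d →
  countOddGaps d n lo ≡ (n + m) C m
countOddGaps-binomial zero m _ _ = sym (nCn≡1 m)
countOddGaps-binomial (suc n) zero {d} {lo} {e} e≤1 eq = begin
  countOddGaps d (suc n) lo
    ≡⟨ countOddGaps-step (subst (lo <_) eq (m<m+n lo z<s)) ⟩
  countOddGaps d n (suc lo) + countOddGaps d (suc n) (2 + lo)
    ≡⟨ cong₂ _+_ (countOddGaps-binomial n zero {d} {suc lo} e≤1 (trans (sym (+-suc lo _)) eq))
                 (countOddGaps-empty d≤) ⟩
  1 + 0
    ∎
  where
  open ≡-Reasoning
  regroup : ∀ lo n → lo + (suc n + 0 + 1) ≡ 2 + lo + n
  regroup = solve-∀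
  d≤ : d ≤ 2 + lo + n
  d≤ = subst (_≤ 2 + lo + n) eq
             (≤-trans (+-monoʳ-≤ lo (+-monoʳ-≤ (suc n + 0) e≤1)) (≤-reflexive (regroup lo n)))
countOddGaps-binomial (suc n) (suc m) {d} {lo} {e} e≤1 eq = begin
  countOddGaps d (suc n) lo
    ≡⟨ countOddGaps-step (subst (lo <_) eq (m<m+n lo z<s)) ⟩
  countOddGaps d n (suc lo) + countOddGaps d (suc n) (2 + lo)
    ≡⟨ cong₂ _+_ (countOddGaps-binomial n (suc m) {d} {suc lo} e≤1 (trans (sym (+-suc lo _)) eq))
                 (countOddGaps-binomial (suc n) m {d} {2 + lo} e≤1 (trans (shift lo n m e) eq)) ⟩
  (n + suc m) C suc m + (suc n + m) C m
    ≡⟨ C-pascal n m ⟩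
  (suc n + suc m) C suc m
    ∎
  where
  open ≡-Reasoning
  shift : ∀ lo n m e → 2 + lo + (suc n + (m + m) + e) ≡ lo + (suc n + (suc m + suc m) + e)
  shift = solve-∀

%2-double : ∀ m → (m + m) % 2 ≡ 0
%2-double zero    = refl
%2-double (suc m) = trans (cong (λ t → suc t % 2) (+-suc m m)) (%2-double m)

%2-suc-double : ∀ m → suc (m + m) % 2 ≡ 1
%2-suc-double zero    = refl
%2-suc-double (suc m) = trans (cong (λ t → suc (suc t) % 2) (+-suc m m)) (%2-suc-double m)

⌊suc-double/2⌋ : ∀ m → ⌊ suc (m + m) /2⌋ ≡ m
⌊suc-double/2⌋ zero    = refl
⌊suc-double/2⌋ (suc m) = cong suc (trans (cong ⌊_/2⌋ (+-suc m m)) (⌊suc-double/2⌋ m))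

U-even : ∀ N k m → k % 2 ≡ 0 → ⌊ k /2⌋ ≡ suc m → U N k ≡ (N ∸ suc m) C suc m + (N ∸ suc m ∸ 1) C m
U-even N k m k-even k/2 rewrite k-even | k/2 = refl

U-odd : ∀ N k m → k % 2 ≡ 1 → ⌊ k /2⌋ ≡ m → U N k ≡ 2 * ((N ∸ m ∸ 1) C m)
U-odd N k m k-odd k/2 rewrite k-odd | k/2 = refl

∸-cancelʳ : ∀ a b c → a + (b + c) ∸ c ≡ a + b
∸-cancelʳ a b c = trans (cong (_∸ c) (sym (+-assoc a b c))) (m+n∸n≡m (a + b) c)

U-double : ∀ n m →
  U (suc n + (suc m + suc m)) (suc m + suc m) ≡ (suc n + suc m) C suc m + (suc n + m) C m
U-double n m = begin
  U N (suc m + suc m)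
    ≡⟨ U-even N _ m (%2-double (suc m)) (sym (n≡⌊n+n/2⌋ (suc m))) ⟩
  (N ∸ suc m) C suc m + (N ∸ suc m ∸ 1) C m
    ≡⟨ cong (λ t → t C suc m + (t ∸ 1) C m) (∸-cancelʳ (suc n) (suc m) (suc m)) ⟩
  (suc n + suc m) C suc m + (suc n + suc m ∸ 1) C m
    ≡⟨ cong (λ t → (suc n + suc m) C suc m + (t ∸ 1) C m) (+-suc (suc n) m) ⟩
  (suc n + suc m) C suc m + (suc n + m) C m
    ∎
  where
  open ≡-Reasoning
  N = suc n + (suc m + suc m)

U-suc-double : ∀ n m →
  U (suc n + suc (m + m)) (suc (m + m)) ≡ (suc n + m) C m + (suc n + m) C m
U-suc-double n m = begin
  U N (suc (m + m))
    ≡⟨ U-odd N _ m (%2-suc-double m) (⌊suc-double/2⌋ m) ⟩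
  2 * ((N ∸ m ∸ 1) C m)
    ≡⟨ cong (λ t → 2 * ((t ∸ 1) C m)) (trans (∸-cancelʳ (suc n) (suc m) m) (+-suc (suc n) m)) ⟩
  2 * ((suc n + m) C m)
    ≡⟨ cong ((suc n + m) C m +_) (+-identityʳ _) ⟩
  (suc n + m) C m + (suc n + m) C m
    ∎
  where
  open ≡-Reasoning
  N = suc n + suc (m + m)

halve : ∀ k → Σ ℕ λ m → k ≡ m + m ⊎ k ≡ suc (m + m)
halve zero = zero , inj₁ refl
halve (suc k) with halve k
... | m , inj₁ refl = m , inj₂ refl
... | m , inj₂ refl = suc m , inj₁ (cong suc (sym (+-suc m m)))

U≡countOddGaps : ∀ n k → let N = suc n + k in
  U N k ≡ countOddGaps N (suc n) 0 + countOddGaps N (suc n) 1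
U≡countOddGaps n k with halve k
... | zero , inj₁ refl = sym (cong₂ _+_
  (countOddGaps-binomial (suc n) zero {suc n + 0} {0} z≤n (+-identityʳ (suc n + 0)))
  (countOddGaps-empty {suc n + 0} {n} {1} (≤-reflexive (+-identityʳ (suc n)))))
... | suc m , inj₁ refl = trans (U-double n m) (sym (cong₂ _+_
  (countOddGaps-binomial (suc n) (suc m) {N} {0} z≤n (+-identityʳ N))
  (countOddGaps-binomial (suc n) m {N} {1} ≤-refl (from-1 n m))))
  where
  N = suc n + (suc m + suc m)
  from-1 : ∀ n m → 1 + (suc n + (m + m) + 1) ≡ suc n + (suc m + suc m)
  from-1 = solve-∀
... | m , inj₂ refl = trans (U-suc-double n m) (sym (cong₂ _+_
  (countOddGaps-binomial (suc n) m {N} {0} ≤-refl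
    (trans (+-assoc (suc n) (m + m) 1) (cong (suc n +_) (+-comm (m + m) 1))))
  (countOddGaps-binomial (suc n) m {N} {1} z≤n
    (trans (cong suc (+-identityʳ _)) (sym (+-suc (suc n) (m + m)))))))
  where
  N = suc n + suc (m + m)

sign : Bool → Sign
sign b = if b then ⊕ else ⊖

checker : ℕ → ℕ → Sign
checker i j = sign (isEven (i + j))

checkerboard : (p d : ℕ) → SignPattern p d
checkerboard p d = tabulate (λ i → tabulate (λ j → checker (toℕ i) (toℕ j)))

nth-vecToList-tabulate : ∀ {A : Set} (z : A) (f : ℕ → A) {n i} → i < n →
  nth z (vecToList (tabulate {n = n} (f ∘ toℕ))) i ≡ f i
nth-vecToList-tabulate z f {suc n} {zero}  _         = refl
nth-vecToList-tabulate z f {suc n} {suc i} (s<s i<n) = nth-vecToList-tabulate z (f ∘ suc) i<n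

nth-map-vecToList-tabulate : ∀ {A B : Set} (z : B) (g : A → B) (f : ℕ → A) {n i} → i < n →
  nth z (map g (vecToList (tabulate {n = n} (f ∘ toℕ)))) i ≡ g (f i)
nth-map-vecToList-tabulate z g f {suc n} {zero}  _         = refl
nth-map-vecToList-tabulate z g f {suc n} {suc i} (s<s i<n) = nth-map-vecToList-tabulate z g (f ∘ suc) i<n

entry-checkerboard : ∀ {p d i j} → i < p → j < d → entry (checkerboard p d) i j ≡ checker i j
entry-checkerboard {i = i} {j} i<p j<d = trans
  (cong (λ row → nth ⊕ row j)
        (nth-map-vecToList-tabulate [] vecToList (λ r → tabulate (λ c → checker r (toℕ c))) i<p))
  (nth-vecToList-tabulate ⊕ (checker i) j<d)

plus-minus : ∀ b → isPlus (sign b) ∧ isMinus (sign (not b)) ≡ b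
plus-minus true  = refl
plus-minus false = refl

minus-plus : ∀ b → isMinus (sign b) ∧ isPlus (sign (not b)) ≡ not b
minus-plus true  = refl
minus-plus false = refl

module OddGapPath {p d lo : ℕ} (a : PathCode p d) (gaps : T (oddGapsFrom lo a)) where
  open Allowed (checkerboard p d) a

  A-step : ∀ {i} → i < p → A i < A (suc i)
  A-step = oddGapsFrom⇒col< a gaps

  A-strict : ∀ {i j} → i < j → j ≤ p → A i < A j
  A-strict {i} {suc j} (s≤s i≤j) j<p with m≤n⇒m<n∨m≡n i≤j
  ... | inj₁ i<j  = <-trans (A-strict i<j (<⇒≤ j<p)) (A-step j<p)
  ... | inj₂ refl = A-step j<p

  onPath⇒ : ∀ {i c} → T (onPath i c) → i < p × A i ≤ c × c ≤ A (suc i)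
  onPath⇒ {i} {c} on with ∧-elim {i <ᵇ p} on
  ... | i<p , rest with ∧-elim {A i ≤ᵇ c} rest
  ... | Ai≤c , c≤A = <ᵇ⇒< i p i<p , ≤ᵇ⇒≤ (A i) c Ai≤c , ≤ᵇ⇒≤ c (A (suc i)) c≤A

  bottom : ∀ {i c} → c < A (suc i) → T (isBottom i c)
  bottom {i} c<A = ∨-introʳ (suc i ≡ᵇ p) (not-intro λ on → <⇒≱ c<A (proj₁ (proj₂ (onPath⇒ on))))

  top : ∀ {i c} → i < p → A i < c → T (isTop i c)
  top {zero}  _ _   = tt
  top {suc i} _ A<c = ∨-introʳ (suc i ≡ᵇ 0) (not-intro λ on → <⇒≱ A<c (proj₂ (proj₂ (onPath⇒ on))))

  top-or-bottom : ∀ {i c} → T (onPath i c) → T (isTop i c ∨ isBottom i c ∨ isPlus (s i c))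
  top-or-bottom {i} {c} on with onPath⇒ on
  ... | i<p , _ , c≤A with m≤n⇒m<n∨m≡n c≤A
  ... | inj₁ c<A  = ∨-introʳ (isTop i c) (∨-introˡ (isPlus (s i c)) (bottom c<A))
  ... | inj₂ refl = ∨-introˡ (isBottom i c ∨ isPlus (s i c)) (top i<p (A-step i<p))

  sign-left : ∀ {i} → i < p → s i (A i) ≡ sign (isEven lo)
  sign-left i<p = trans (entry-checkerboard i<p (col<d a (<⇒≤ i<p)))
                        (cong sign (oddGapsFrom⇒isEven≡ a gaps (<⇒≤ i<p)))

  sign-right : ∀ {i} → i < p → s i (A (suc i)) ≡ sign (not (isEven lo))
  sign-right i<p = trans (entry-checkerboard i<p (col<d a i<p))
    (cong sign (trans (sym (not-involutive _)) (cong not (oddGapsFrom⇒isEven≡ a gaps i<p))))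

  pairPM≡ : ∀ {i} → i < p → pairPM i ≡ isEven lo
  pairPM≡ i<p = trans (cong₂ (λ x y → isPlus x ∧ isMinus y) (sign-left i<p) (sign-right i<p))
                      (plus-minus (isEven lo))

  pairMP≡ : ∀ {i} → i < p → pairMP i ≡ not (isEven lo)
  pairMP≡ i<p = trans (cong₂ (λ x y → isMinus x ∧ isPlus y) (sign-left i<p) (sign-right i<p))
                      (minus-plus (isEven lo))

  condI-holds : T condI
  condI-holds = every-upTo λ {i} i<p →
    →-intro {onPath i (A 0)} λ _ → ∨-introˡ (isPlus (s i (A 0))) (bottom (A-strict z<s i<p))

  condII-holds : T condII
  condII-holds = every-upTo λ {i} i<p →
    →-intro {onPath i (A p)} λ _ → ∨-introˡ (isPlus (s i (A p))) (top i<p (A-strict i<p ≤-refl))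

  condIII-holds : T condIII
  condIII-holds = every-upTo {n = d} λ {c} _ → ∨-introʳ (c ≡ᵇ A 0) (∨-introʳ (c ≡ᵇ A p)
    (every-upTo {n = p} λ {i} _ → →-intro {onPath i c} top-or-bottom))

  condIV-holds : T condIV
  condIV-holds = every-upTo λ {i} i<p →
    subst₂ (λ x y → T (not (horizontal i) ∨ x ∨ y)) (sym (pairPM≡ i<p)) (sym (pairMP≡ i<p))
           (T-not∨b∨not-b (horizontal i) (isEven lo))

  condV-holds : T condV
  condV-holds = every-upTo λ {i} i<p → every-upTo λ {j} j<p →
    subst (λ y → T (not (i <ᵇ j) ∨ not (horizontal i ∧ pairMP i) ∨ not (horizontal j) ∨ y))
          (trans (pairMP≡ i<p) (sym (pairMP≡ j<p)))
          (T-∨-not-∧-∨ (not (i <ᵇ j)) (horizontal i) (not (horizontal j)) (pairMP i))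

  allowed-path : T (isPath a ∧ tropicallyAllowed (checkerboard p d) a)
  allowed-path = ∧-intro (every-upTo {n = p} λ i<p → ≤⇒≤ᵇ (<⇒≤ (A-step i<p)))
    (∧-intro condI-holds (∧-intro condII-holds (∧-intro condIII-holds (∧-intro condIV-holds condV-holds))))

countOddGaps≤numAllowedPaths : ∀ p d →
  countOddGaps d (suc p) 0 + countOddGaps d (suc p) 1 ≤ numAllowedPaths (checkerboard p d)
countOddGaps≤numAllowedPaths p d = begin
  countOddGaps d (suc p) 0 + countOddGaps d (suc p) 1
    ≡⟨ sym (total-map-+ (indicator ∘ oddGapsFrom 0) (indicator ∘ oddGapsFrom 1) (allPathCodes p d)) ⟩
  total (map (λ a → indicator (oddGapsFrom 0 a) + indicator (oddGapsFrom 1 a)) (allPathCodes p d))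
    ≤⟨ total-map-mono (λ a → indicator-+-≤ (oddGapsFrom 0 a) (oddGapsFrom 1 a)
                        (OddGapPath.allowed-path a) (OddGapPath.allowed-path a)
                        (oddGapsFrom-0-1-disjoint a))
                      (allPathCodes p d) ⟩
  numAllowedPaths (checkerboard p d)
    ∎
  where open ≤-Reasoning

≤-foldr-⊔ : ∀ {A : Set} (f : A → ℕ) {x} {xs : List A} → x ∈ xs → f x ≤ foldr _⊔_ 0 (map f xs)
≤-foldr-⊔ f {xs = y ∷ ys} (here refl) = m≤m⊔n (f y) _
≤-foldr-⊔ f {xs = y ∷ ys} (there x∈ys) = ≤-trans (≤-foldr-⊔ f x∈ys) (m≤n⊔m (f y) _)

vecsOf-complete : ∀ {A : Set} {xs : List A} → (∀ x → x ∈ xs) → ∀ {n} (v : Vec A n) → v ∈ vecsOf n xs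
vecsOf-complete all []      = here refl
vecsOf-complete {xs = xs} all {suc n} (x ∷ v) =
  ∈-concatMap⁺ (λ y → map (y ∷_) (vecsOf n xs))
               (Any.map (λ { refl → ∈-map⁺ (x ∷_) (vecsOf-complete all v) }) (all x))

numAllowedPaths≤Ntrop : ∀ {p d} (ε : SignPattern p d) → numAllowedPaths ε ≤ Ntrop p d
numAllowedPaths≤Ntrop ε = ≤-foldr-⊔ numAllowedPaths (vecsOf-complete (vecsOf-complete sign∈) ε)
  where
  sign∈ : ∀ s → s ∈ ⊕ ∷ ⊖ ∷ []
  sign∈ ⊕ = here refl
  sign∈ ⊖ = there (here refl)

proposition19 : (p d : ℕ) → 1 ≤ p → 2 * p + 1 ≤ d →
    U d (d ∸ p ∸ 1) ≤ Ntrop p d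
proposition19 p d _ 2p+1≤d = subst (λ N → U N k ≤ Ntrop p N) N≡d (begin
  U N k                                                  ≡⟨ U≡countOddGaps p k ⟩
  countOddGaps N (suc p) 0 + countOddGaps N (suc p) 1    ≤⟨ countOddGaps≤numAllowedPaths p N ⟩
  numAllowedPaths (checkerboard p N)                     ≤⟨ numAllowedPaths≤Ntrop (checkerboard p N) ⟩
  Ntrop p N                                              ∎)
  where
  open ≤-Reasoning
  k = d ∸ p ∸ 1
  N = suc p + k
  p<d : p < d
  p<d = ≤-trans (≤-trans (≤-reflexive (+-comm 1 p)) (+-monoˡ-≤ 1 (m≤m+n p (p + 0)))) 2p+1≤d
  N≡d : N ≡ d
  N≡d = trans (cong (suc p +_) (trans (∸-+-assoc d p 1) (cong (d ∸_) (+-comm p 1)))) (m+[n∸m]≡n p<d)
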